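{- Let $G$ be a connected graph whose set $V_1=\{v_1,\dots,v_i\}$ of degree-one vertices is nonempty. Let $G\bigoplus V_1'$ denote the graph obtained from $G$ by adding $i$ new vertices $v_1',\dots,v_i'$ and the $i$ new edges $v_1v_1',\dots,v_iv_i'$. If $G$ is strongly antimagic, then $G\bigoplus V_1'$ is strongly antimagic.
   Context: For a graph $G=(V,E)$ and a bijection $f:E\to\{1,2,\dots,|E|\}$, the vertex-sum at $u\in V$ is $\varphi_f(u)=\sum_{e\in E(u)}f(e)$, where $E(u)$ is the set of edges incident to $u$. The bijection $f$ is a strongly antimagic labeling if $\varphi_f(u)\neq\varphi_f(v)$ for all distinct vertices $u,v$, and moreover $\varphi_f(u)<\varphi_f(v)$ whenever $\deg(u)<\deg(v)$. A graph is strongly antimagic if it has a strongly antimagic labeling. -}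

module Defs where

open import Data.Nat using (ℕ; zero; suc; _+_; _<_)
open import Data.Fin using (Fin; toℕ; _↑ˡ_; _↑ʳ_; splitAt; _≟_)
open import Data.Fin.Permutation using (Permutation′; _⟨$⟩ʳ_)
open import Data.Bool using (Bool; true; false; if_then_else_; _∨_)
open import Data.Product using (_×_; _,_; proj₁; proj₂; ∃; Σ-syntax)
open import Data.Sum using (_⊎_; inj₁; inj₂)
open import Data.List using (List; map; filter; length; allFin)
open import Data.Nat.ListAction using (sum)
open import Relation.Nullary using (¬_; ⌊_⌋)
open import Relation.Binary.PropositionalEquality using (_≡_; _≢_)
open import Relation.Binary.Construct.Closure.ReflexiveTransitive using (Star)
import Data.Nat as ℕ
open import Data.List using (lookup)

record Graph : Set where
  constructor graph
  field
    n    : ℕ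
    m    : ℕ
    ends : Fin m → Fin n × Fin n
open Graph public

SameEnds : ∀ {n} → Fin n × Fin n → Fin n × Fin n → Set
SameEnds (a , b) (c , d) = (a ≡ c × b ≡ d) ⊎ (a ≡ d × b ≡ c)

IsSimple : Graph → Set
IsSimple G = (∀ e → proj₁ (ends G e) ≢ proj₂ (ends G e))
           × (∀ e e′ → SameEnds (ends G e) (ends G e′) → e ≡ e′)

incident : (G : Graph) → Fin (n G) → Fin (m G) → Bool
incident G u e = ⌊ u ≟ proj₁ (ends G e) ⌋ ∨ ⌊ u ≟ proj₂ (ends G e) ⌋

deg : (G : Graph) → Fin (n G) → ℕ
deg G u = length (filter (λ e → u ≟′ e) (allFin (m G)))
  where
  open import Relation.Nullary.Decidable using (Dec)
  open import Data.Bool.Properties using () renaming (_≟_ to _≟ᵇ_)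
  _≟′_ : (u : Fin (n G)) (e : Fin (m G)) → Relation.Nullary.Dec (incident G u e ≡ true)
  u ≟′ e = incident G u e ≟ᵇ true

Adj : (G : Graph) → Fin (n G) → Fin (n G) → Set
Adj G u v = ∃ λ e → SameEnds (ends G e) (u , v)

Connected : Graph → Set
Connected G = ∀ u v → Star (Adj G) u v

-- An edge labeling: a bijection f : E → {1,…,|E|}, encoded as a permutation
-- of Fin m, with the label of e being 1 + (position of e).
Labeling : Graph → Set
Labeling G = Permutation′ (m G)

label : (G : Graph) → Labeling G → Fin (m G) → ℕ
label G f e = suc (toℕ (f ⟨$⟩ʳ e))

vsum : (G : Graph) → Labeling G → Fin (n G) → ℕ
vsum G f u = sum (map (λ e → if incident G u e then label G f e else 0) (allFin (m G)))

IsStronglyAntimagicLabeling : (G : Graph) → Labeling G → Set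
IsStronglyAntimagicLabeling G f =
    (∀ u v → u ≢ v → vsum G f u ≢ vsum G f v)
  × (∀ u v → deg G u < deg G v → vsum G f u < vsum G f v)

StronglyAntimagic : Graph → Set
StronglyAntimagic G = ∃ λ f → IsStronglyAntimagicLabeling G f

leaves : (G : Graph) → List (Fin (n G))
leaves G = filter (λ u → deg G u ℕ.≟ 1) (allFin (n G))

-- G ⊕ V₁′: add i new vertices v₁′,…,vᵢ′ (numbered n,…,n+i-1) and new edges vⱼvⱼ′
-- (numbered m,…,m+i-1).
addPendants : Graph → Graph
addPendants G = graph (n G + k) (m G + k) newEnds
  where
  k = length (leaves G)
  newEnds : Fin (m G + k) → Fin (n G + k) × Fin (n G + k)
  newEnds e with splitAt (m G) e
  ... | inj₁ old = let (a , b) = ends G old in (a ↑ˡ k , b ↑ˡ k)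
  ... | inj₂ j   = (lookup (leaves G) j ↑ˡ k , n G ↑ʳ j)

-- Shift every label of G up by i and give the i new pendant edges the labels 1, …, i, in the
-- order of the vertex sums of their leaves. An old vertex u then has vertex sum
-- φ(u) + i·deg(u), plus the label of its pendant edge if u is a leaf. A pendant label is at
-- most i, so the term i·deg(u) keeps vertices of different degree in order, and two leaves
-- are kept apart by the order of their pendant labels. A new vertex has degree 1 and vertex
-- sum at most i, below every old vertex sum because connectedness and the existence of a leaf
-- leave no vertex of G isolated.

module Submission where

open import Defs

open import Data.Bool using (Bool; true; false; if_then_else_; _∨_)
open import Data.Bool.Properties using (∨-identityʳ; ∨-zeroʳ) renaming (_≟_ to _≟ᵇ_)
open import Data.Fin using (Fin; zero; suc; toℕ; cast; join; _≟_; _↑ˡ_; _↑ʳ_; splitAt; punchIn)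
import Data.Fin.Properties as Fin
open import Data.Fin.Permutation using (Permutation; Permutation′; _⟨$⟩ʳ_; _⟨$⟩ˡ_; inverseˡ; cast-id; _∘ₚ_)
open import Data.List using (List; []; _∷_; map; filter; length; lookup; tabulate; allFin)
open import Data.List.Properties using (map-tabulate; length-tabulate; lookup-tabulate)
open import Data.List.Membership.Propositional using (_∈_)
open import Data.List.Membership.Propositional.Properties using (∈-lookup; ∈-filter⁻; ∈-filter⁺; ∈-allFin)
open import Data.List.Relation.Binary.Permutation.Homogeneous using (onIndices)
open import Data.List.Relation.Binary.Permutation.Propositional using (↭⇒↭ₛ; ↭-sym)
open import Data.List.Relation.Binary.Permutation.Propositional.Properties using (↭-length)
import Data.List.Relation.Unary.All as All
open import Data.List.Relation.Unary.AllPairs using (_∷_)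
open import Data.List.Relation.Unary.Any using (here; index)
open import Data.List.Relation.Unary.Any.Properties using (lookup-index)
open import Data.List.Relation.Unary.Sorted.TotalOrder.Properties using (lookup-mono-≤)
open import Data.List.Relation.Unary.Unique.Propositional using (Unique)
open import Data.List.Relation.Unary.Unique.Propositional.Properties using (allFin⁺; filter⁺)
open import Data.Nat using (ℕ; zero; suc; _+_; _*_; _≤_; _<_; _<?_; s≤s; z≤n)
import Data.Nat as ℕ
open import Data.Nat.ListAction using () renaming (sum to sumˡ)
open import Data.Nat.Properties hiding (_≟_)
open import Algebra.Properties.Semiring.Sum +-*-semiring
  using (sum-syntax; sum-cong-≗; sum-remove; sum-replicate-zero; ∑-distrib-+; *-distribˡ-sum)
open import Data.Nat.Solver using (module +-*-Solver)
open import Data.Product using (∃-syntax; Σ-syntax; _,_; proj₁; proj₂)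
open import Data.Sum using (inj₁; inj₂)
open import Data.Sum.Algebra using (⊎-comm)
open import Data.Sum.Function.Propositional using (_⊎-↔_)
open import Function using (_∘_)
open import Function.Construct.Composition using (_↔-∘_)
open import Function.Construct.Symmetry using (↔-sym)
open import Relation.Binary.Construct.Closure.ReflexiveTransitive using (Star; ε; _◅_)
open import Relation.Binary.Definitions using (tri<; tri≈; tri>)
open import Relation.Binary.PropositionalEquality
open import Relation.Nullary using (¬_; ⌊_⌋; yes; no; contradiction)
open import Relation.Nullary.Decidable using (Dec; isYes≗does; dec-true; dec-false)
open import Data.List.Sort ≤-decTotalOrder using (sort; sort-↭; sort-↗)
open import Data.List.Relation.Binary.Permutation.Setoid (setoid ℕ) using () renaming (_↭_ to _↭ₛ_)
open import Data.List.Relation.Binary.Permutation.Setoid.Properties (setoid ℕ) using (onIndices-lookup)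

sum-tabulate : ∀ {k} (h : Fin k → ℕ) → sumˡ (tabulate h) ≡ ∑[ i < k ] h i
sum-tabulate {zero}  h = refl
sum-tabulate {suc k} h = cong (h zero +_) (sum-tabulate (λ i → h (suc i)))

sum-map-allFin : ∀ {k} (h : Fin k → ℕ) → sumˡ (map h (allFin k)) ≡ ∑[ i < k ] h i
sum-map-allFin h = trans (cong sumˡ (map-tabulate (λ i → i) h)) (sum-tabulate h)

length-filter≡sum : {A : Set} (b : A → Bool) (xs : List A) →
  length (filter (λ x → b x ≟ᵇ true) xs) ≡ sumˡ (map (λ x → if b x then 1 else 0) xs)
length-filter≡sum b []       = refl
length-filter≡sum b (x ∷ xs) with b x
... | true  = cong suc (length-filter≡sum b xs)
... | false = length-filter≡sum b xs

∑-↑ˡ-↑ʳ : ∀ m {k} (h : Fin (m + k) → ℕ) →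
  ∑[ i < m + k ] h i ≡ ∑[ i < m ] h (i ↑ˡ k) + ∑[ j < k ] h (m ↑ʳ j)
∑-↑ˡ-↑ʳ zero    h = refl
∑-↑ˡ-↑ʳ (suc m) h = trans (cong (h zero +_) (∑-↑ˡ-↑ʳ m (λ i → h (suc i)))) (sym (+-assoc (h zero) _ _))

∑-mono-≤ : ∀ {k} {g h : Fin k → ℕ} → (∀ i → g i ≤ h i) → ∑[ i < k ] g i ≤ ∑[ i < k ] h i
∑-mono-≤ {zero}  g≤h = z≤n
∑-mono-≤ {suc k} g≤h = +-mono-≤ (g≤h zero) (∑-mono-≤ (λ i → g≤h (suc i)))

≤-∑ : ∀ {k} (h : Fin k → ℕ) (i : Fin k) → h i ≤ ∑[ j < k ] h j
≤-∑ {suc k} h i = subst (h i ≤_) (sym (sum-remove {i = i} h)) (m≤m+n (h i) _)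

∑-zero : ∀ {k} {h : Fin k → ℕ} → (∀ i → h i ≡ 0) → ∑[ i < k ] h i ≡ 0
∑-zero {k} h≡0 = trans (sum-cong-≗ h≡0) (sum-replicate-zero k)

∑-single : ∀ {k} {h : Fin k → ℕ} (i : Fin k) → (∀ j → j ≢ i → h j ≡ 0) → ∑[ j < k ] h j ≡ h i
∑-single {suc k} {h} i h≡0 = begin
  ∑[ j < suc k ] h j                ≡⟨ sum-remove {i = i} h ⟩
  h i + ∑[ j < k ] h (punchIn i j)  ≡⟨ cong (h i +_) (∑-zero (λ j → h≡0 _ (Fin.punchInᵢ≢i i j))) ⟩
  h i + 0                           ≡⟨ +-identityʳ (h i) ⟩
  h i                               ∎
  where open ≡-Reasoning

ranking : ∀ {k} (w : Fin k → ℕ) →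
  Σ[ σ ∈ Permutation′ k ] (∀ i j → w i < w j → toℕ (σ ⟨$⟩ʳ i) < toℕ (σ ⟨$⟩ʳ j))
ranking {k} w = σ , σ-mono
  where
  xs : List ℕ
  xs = tabulate w
  xs↭sorted : xs ↭ₛ sort xs
  xs↭sorted = ↭⇒↭ₛ (↭-sym (sort-↭ xs))
  k≡len : k ≡ length xs
  k≡len = sym (length-tabulate w)
  len≡k : length (sort xs) ≡ k
  len≡k = trans (↭-length (sort-↭ xs)) (length-tabulate w)
  π : Permutation (length xs) (length (sort xs))
  π = onIndices xs↭sorted
  σ : Permutation′ k
  σ = cast-id k≡len ∘ₚ (π ∘ₚ cast-id len≡k)

  position : Fin k → Fin (length (sort xs))
  position i = π ⟨$⟩ʳ cast k≡len i

  sorted-at : ∀ i → lookup (sort xs) (position i) ≡ w i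
  sorted-at i = trans (sym (onIndices-lookup xs↭sorted (cast k≡len i))) (lookup-tabulate w i)

  toℕ-σ : ∀ i → toℕ (σ ⟨$⟩ʳ i) ≡ toℕ (position i)
  toℕ-σ i = Fin.toℕ-cast len≡k (position i)

  σ-mono : ∀ i j → w i < w j → toℕ (σ ⟨$⟩ʳ i) < toℕ (σ ⟨$⟩ʳ j)
  σ-mono i j wi<wj with toℕ (σ ⟨$⟩ʳ i) <? toℕ (σ ⟨$⟩ʳ j)
  ... | yes σi<σj = σi<σj
  ... | no σi≮σj = contradiction wi<wj (≤⇒≯ (subst₂ _≤_ (sorted-at j) (sorted-at i)
          (lookup-mono-≤ ≤-totalOrder (sort-↗ xs)
            (subst₂ _≤_ (toℕ-σ j) (toℕ-σ i) (≮⇒≥ σi≮σj)))))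

_⊕ₚ_ : ∀ {m k} → Permutation′ m → Permutation′ k → Permutation′ (m + k)
_⊕ₚ_ {m} {k} f σ =
  cast-id (+-comm k m) ↔-∘
    (↔-sym (Fin.+↔⊎ {k} {m}) ↔-∘ (⊎-comm _ _ ↔-∘ ((f ⊎-↔ σ) ↔-∘ Fin.+↔⊎ {m} {k})))

module _ {m k} (f : Permutation′ m) (σ : Permutation′ k) where

  ⊕ₚ-↑ˡ : ∀ e → toℕ ((f ⊕ₚ σ) ⟨$⟩ʳ (e ↑ˡ k)) ≡ k + toℕ (f ⟨$⟩ʳ e)
  ⊕ₚ-↑ˡ e rewrite Fin.splitAt-↑ˡ m e k =
    trans (Fin.toℕ-cast (+-comm k m) (k ↑ʳ (f ⟨$⟩ʳ e))) (Fin.toℕ-↑ʳ k (f ⟨$⟩ʳ e))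

  ⊕ₚ-↑ʳ : ∀ j → toℕ ((f ⊕ₚ σ) ⟨$⟩ʳ (m ↑ʳ j)) ≡ toℕ (σ ⟨$⟩ʳ j)
  ⊕ₚ-↑ʳ j rewrite Fin.splitAt-↑ʳ m k j =
    trans (Fin.toℕ-cast (+-comm k m) ((σ ⟨$⟩ʳ j) ↑ˡ m)) (Fin.toℕ-↑ˡ (σ ⟨$⟩ʳ j) m)

⌊⌋-true : ∀ {A : Set} (a? : Dec A) → A → ⌊ a? ⌋ ≡ true
⌊⌋-true a? a = trans (isYes≗does a?) (dec-true a? a)

⌊⌋-false : ∀ {A : Set} (a? : Dec A) → ¬ A → ⌊ a? ⌋ ≡ false
⌊⌋-false a? ¬a = trans (isYes≗does a?) (dec-false a? ¬a)

⌊≟⌋-injective : ∀ {a b} {f : Fin a → Fin b} → (∀ {x y} → f x ≡ f y → x ≡ y) →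
  ∀ x y → ⌊ f x ≟ f y ⌋ ≡ ⌊ x ≟ y ⌋
⌊≟⌋-injective {f = f} inj x y with x ≟ y
... | yes refl = ⌊⌋-true (f x ≟ f x) refl
... | no x≢y   = ⌊⌋-false (f x ≟ f y) (x≢y ∘ inj)

↑ˡ≢↑ʳ : ∀ {a b} (i : Fin a) (j : Fin b) → i ↑ˡ b ≢ a ↑ʳ j
↑ˡ≢↑ʳ {a} {b} i j eq
  with trans (sym (Fin.splitAt-↑ˡ a i b)) (trans (cong (splitAt a) eq) (Fin.splitAt-↑ʳ a b j))
... | ()

data SplitView (a b : ℕ) : Fin (a + b) → Set where
  left  : ∀ i → SplitView a b (i ↑ˡ b)
  right : ∀ j → SplitView a b (a ↑ʳ j)

splitView : ∀ a b x → SplitView a b x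
splitView a b x = subst (SplitView a b) (Fin.join-splitAt a b x) (view (splitAt a x))
  where
  view : ∀ p → SplitView a b (join a b p)
  view (inj₁ i) = left i
  view (inj₂ j) = right j

Unique⇒lookup-injective : ∀ {A : Set} {xs : List A} → Unique xs → ∀ i j → lookup xs i ≡ lookup xs j → i ≡ j
Unique⇒lookup-injective (x∉ ∷ u) zero    zero    eq = refl
Unique⇒lookup-injective (x∉ ∷ u) zero    (suc j) eq = contradiction eq (All.lookup x∉ (∈-lookup j))
Unique⇒lookup-injective (x∉ ∷ u) (suc i) zero    eq = contradiction (sym eq) (All.lookup x∉ (∈-lookup i))
Unique⇒lookup-injective (x∉ ∷ u) (suc i) (suc j) eq = cong suc (Unique⇒lookup-injective u i j eq)

incidenceSum : (G : Graph) → (Fin (m G) → ℕ) → Fin (n G) → ℕ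
incidenceSum G w u = ∑[ e < m G ] (if incident G u e then w e else 0)

module _ (G : Graph) where

  deg≡incidenceSum : ∀ u → deg G u ≡ incidenceSum G (λ _ → 1) u
  deg≡incidenceSum u = trans (length-filter≡sum (incident G u) (allFin (m G)))
                             (sum-map-allFin (λ e → if incident G u e then 1 else 0))

  vsum≡incidenceSum : ∀ f u → vsum G f u ≡ incidenceSum G (label G f) u
  vsum≡incidenceSum f u = sum-map-allFin (λ e → if incident G u e then label G f e else 0)

  incidenceSum-mono : ∀ {v w} → (∀ e → v e ≤ w e) → ∀ u → incidenceSum G v u ≤ incidenceSum G w u
  incidenceSum-mono {v} {w} v≤w u = ∑-mono-≤ term
    where
    term : ∀ e → (if incident G u e then v e else 0) ≤ (if incident G u e then w e else 0)
    term e with incident G u e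
    ... | true  = v≤w e
    ... | false = z≤n

  deg≤vsum : ∀ f u → deg G u ≤ vsum G f u
  deg≤vsum f u = subst₂ _≤_ (sym (deg≡incidenceSum u)) (sym (vsum≡incidenceSum f u))
    (incidenceSum-mono (λ _ → s≤s z≤n) u)

  Adj⇒1≤deg : ∀ {u v} → Adj G u v → 1 ≤ deg G u
  Adj⇒1≤deg {u} (e , uv) = subst (1 ≤_) (sym (deg≡incidenceSum u))
    (≤-trans (subst (λ b → 1 ≤ (if b then 1 else 0)) (sym (incident≡true uv)) ≤-refl) (≤-∑ _ e))
    where
    incident≡true : ∀ {v} → SameEnds (ends G e) (u , v) → incident G u e ≡ true
    incident≡true (inj₁ (u≡ , _)) rewrite ⌊⌋-true (u ≟ proj₁ (ends G e)) (sym u≡) = refl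
    incident≡true (inj₂ (_ , u≡)) rewrite ⌊⌋-true (u ≟ proj₂ (ends G e)) (sym u≡) = ∨-zeroʳ _

  path⇒1≤deg : ∀ {u v} → Star (Adj G) u v → 1 ≤ deg G v → 1 ≤ deg G u
  path⇒1≤deg ε           1≤dv = 1≤dv
  path⇒1≤deg (uw ◅ _)    _    = Adj⇒1≤deg uw

  incidenceSum-shift : ∀ c w u → incidenceSum G (λ e → c + w e) u ≡ c * deg G u + incidenceSum G w u
  incidenceSum-shift c w u = begin
    incidenceSum G (λ e → c + w e) u
      ≡⟨ sum-cong-≗ (λ e → split (incident G u e) (w e)) ⟩
    ∑[ e < m G ] (c * (if incident G u e then 1 else 0) + (if incident G u e then w e else 0))
      ≡⟨ ∑-distrib-+ (λ e → c * (if incident G u e then 1 else 0)) (λ e → if incident G u e then w e else 0) ⟩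
    ∑[ e < m G ] (c * (if incident G u e then 1 else 0)) + incidenceSum G w u
      ≡⟨ cong (_+ incidenceSum G w u) (*-distribˡ-sum c (λ e → if incident G u e then 1 else 0)) ⟨
    c * incidenceSum G (λ _ → 1) u + incidenceSum G w u
      ≡⟨ cong (λ d → c * d + incidenceSum G w u) (deg≡incidenceSum u) ⟨
    c * deg G u + incidenceSum G w u ∎
    where
    open ≡-Reasoning
    split : ∀ b x → (if b then c + x else 0) ≡ c * (if b then 1 else 0) + (if b then x else 0)
    split true  x = cong (_+ x) (sym (*-identityʳ c))
    split false x = sym (trans (+-identityʳ (c * 0)) (*-zeroʳ c))

pendantDeg : ℕ → ℕ
pendantDeg 1 = 2
pendantDeg d = d

pendantDeg-≢1 : ∀ {d} → d ≢ 1 → pendantDeg d ≡ d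
pendantDeg-≢1 {zero}          _   = refl
pendantDeg-≢1 {suc zero}      d≢1 = contradiction refl d≢1
pendantDeg-≢1 {suc (suc d)}   _   = refl

pendantDeg-mono-≤ : ∀ {a b} → a ≤ b → pendantDeg a ≤ pendantDeg b
pendantDeg-mono-≤ {zero}        _                 = z≤n
pendantDeg-mono-≤ {suc zero}    {suc zero}    _   = ≤-refl
pendantDeg-mono-≤ {suc zero}    {suc (suc b)} _   = s≤s (s≤s z≤n)
pendantDeg-mono-≤ {suc (suc a)} {suc zero}    (s≤s ())
pendantDeg-mono-≤ {suc (suc a)} {suc (suc b)} a≤b = a≤b

pendantDeg-cancel-< : ∀ {a b} → pendantDeg a < pendantDeg b → a < b
pendantDeg-cancel-< {a} {b} lt = ≰⇒> (λ b≤a → <⇒≱ lt (pendantDeg-mono-≤ b≤a))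

≤-pendantDeg : ∀ d → d ≤ pendantDeg d
≤-pendantDeg zero          = z≤n
≤-pendantDeg (suc zero)    = s≤s z≤n
≤-pendantDeg (suc (suc d)) = ≤-refl

module PendantExtension (G : Graph) where

  k : ℕ
  k = length (leaves G)

  G⁺ : Graph
  G⁺ = addPendants G

  leaf : Fin k → Fin (n G)
  leaf = lookup (leaves G)

  leaf-deg : ∀ j → deg G (leaf j) ≡ 1
  leaf-deg j = proj₂ (∈-filter⁻ (λ u → deg G u ℕ.≟ 1) {xs = allFin (n G)} (∈-lookup j))

  leaf-injective : ∀ {i j} → leaf i ≡ leaf j → i ≡ j
  leaf-injective = Unique⇒lookup-injective (filter⁺ (λ u → deg G u ℕ.≟ 1) (allFin⁺ (n G))) _ _

  data LeafView : Fin (n G) → Set where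
    isLeaf  : ∀ j → LeafView (leaf j)
    notLeaf : ∀ {u} → deg G u ≢ 1 → LeafView u

  leafView : ∀ u → LeafView u
  leafView u with deg G u ℕ.≟ 1
  ... | no d≢1 = notLeaf d≢1
  ... | yes d≡1 = subst LeafView (sym (lookup-index u∈leaves)) (isLeaf (index u∈leaves))
    where
    u∈leaves : u ∈ leaves G
    u∈leaves = ∈-filter⁺ (λ u → deg G u ℕ.≟ 1) (∈-allFin u) d≡1

  ⌊old≟old⌋ : ∀ (u v : Fin (n G)) → ⌊ u ↑ˡ k ≟ v ↑ˡ k ⌋ ≡ ⌊ u ≟ v ⌋
  ⌊old≟old⌋ = ⌊≟⌋-injective (Fin.↑ˡ-injective k _ _)

  ⌊new≟old⌋ : ∀ i (v : Fin (n G)) → ⌊ n G ↑ʳ i ≟ v ↑ˡ k ⌋ ≡ false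
  ⌊new≟old⌋ i v = ⌊⌋-false (n G ↑ʳ i ≟ v ↑ˡ k) (↑ˡ≢↑ʳ v i ∘ sym)

  incident-old-old : ∀ u e → incident G⁺ (u ↑ˡ k) (e ↑ˡ k) ≡ incident G u e
  incident-old-old u e rewrite Fin.splitAt-↑ˡ (m G) e k =
    cong₂ _∨_ (⌊old≟old⌋ u (proj₁ (ends G e))) (⌊old≟old⌋ u (proj₂ (ends G e)))

  incident-old-new : ∀ u j → incident G⁺ (u ↑ˡ k) (m G ↑ʳ j) ≡ ⌊ u ≟ leaf j ⌋
  incident-old-new u j rewrite Fin.splitAt-↑ʳ (m G) k j =
    trans (cong₂ _∨_ (⌊old≟old⌋ u (leaf j)) (⌊⌋-false (u ↑ˡ k ≟ n G ↑ʳ j) (↑ˡ≢↑ʳ u j)))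
          (∨-identityʳ _)

  incident-new-old : ∀ i e → incident G⁺ (n G ↑ʳ i) (e ↑ˡ k) ≡ false
  incident-new-old i e rewrite Fin.splitAt-↑ˡ (m G) e k =
    cong₂ _∨_ (⌊new≟old⌋ i (proj₁ (ends G e))) (⌊new≟old⌋ i (proj₂ (ends G e)))

  incident-new-new : ∀ i j → incident G⁺ (n G ↑ʳ i) (m G ↑ʳ j) ≡ ⌊ i ≟ j ⌋
  incident-new-new i j rewrite Fin.splitAt-↑ʳ (m G) k j =
    cong₂ _∨_ (⌊new≟old⌋ i (leaf j)) (⌊≟⌋-injective (Fin.↑ʳ-injective (n G) _ _) i j)

  pendantSum : (Fin k → ℕ) → Fin (n G) → ℕ
  pendantSum w u = ∑[ j < k ] (if ⌊ u ≟ leaf j ⌋ then w j else 0)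

  pendantSum-leaf : ∀ w j → pendantSum w (leaf j) ≡ w j
  pendantSum-leaf w j = trans (∑-single j other) (cong (if_then w j else 0) (⌊⌋-true (leaf j ≟ leaf j) refl))
    where
    other : ∀ i → i ≢ j → (if ⌊ leaf j ≟ leaf i ⌋ then w i else 0) ≡ 0
    other i i≢j rewrite ⌊⌋-false (leaf j ≟ leaf i) (i≢j ∘ sym ∘ leaf-injective) = refl

  pendantSum-notLeaf : ∀ w {u} → deg G u ≢ 1 → pendantSum w u ≡ 0
  pendantSum-notLeaf w {u} d≢1 = ∑-zero term
    where
    term : ∀ j → (if ⌊ u ≟ leaf j ⌋ then w j else 0) ≡ 0
    term j rewrite ⌊⌋-false (u ≟ leaf j) (λ u≡ → d≢1 (trans (cong (deg G) u≡) (leaf-deg j))) = refl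

  incidenceSum-old : ∀ w u → incidenceSum G⁺ w (u ↑ˡ k) ≡
    incidenceSum G (λ e → w (e ↑ˡ k)) u + pendantSum (λ j → w (m G ↑ʳ j)) u
  incidenceSum-old w u = trans (∑-↑ˡ-↑ʳ (m G) _) (cong₂ _+_
    (sum-cong-≗ (λ e → cong (if_then w (e ↑ˡ k) else 0) (incident-old-old u e)))
    (sum-cong-≗ (λ j → cong (if_then w (m G ↑ʳ j) else 0) (incident-old-new u j))))

  incidenceSum-new : ∀ w i → incidenceSum G⁺ w (n G ↑ʳ i) ≡ w (m G ↑ʳ i)
  incidenceSum-new w i = begin
    incidenceSum G⁺ w (n G ↑ʳ i)
      ≡⟨ ∑-↑ˡ-↑ʳ (m G) _ ⟩
    ∑[ e < m G ] (if incident G⁺ (n G ↑ʳ i) (e ↑ˡ k) then w (e ↑ˡ k) else 0) +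
    ∑[ j < k ] (if incident G⁺ (n G ↑ʳ i) (m G ↑ʳ j) then w (m G ↑ʳ j) else 0)
      ≡⟨ cong₂ _+_ (∑-zero (λ e → cong (if_then w (e ↑ˡ k) else 0) (incident-new-old i e)))
                   (∑-single i other) ⟩
    (if incident G⁺ (n G ↑ʳ i) (m G ↑ʳ i) then w (m G ↑ʳ i) else 0)
      ≡⟨ cong (if_then w (m G ↑ʳ i) else 0) (trans (incident-new-new i i) (⌊⌋-true (i ≟ i) refl)) ⟩
    w (m G ↑ʳ i) ∎
    where
    open ≡-Reasoning
    other : ∀ j → j ≢ i → (if incident G⁺ (n G ↑ʳ i) (m G ↑ʳ j) then w (m G ↑ʳ j) else 0) ≡ 0
    other j j≢i rewrite incident-new-new i j | ⌊⌋-false (i ≟ j) (j≢i ∘ sym) = refl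

  deg-old : ∀ u → deg G⁺ (u ↑ˡ k) ≡ pendantDeg (deg G u)
  deg-old u = begin
    deg G⁺ (u ↑ˡ k)
      ≡⟨ deg≡incidenceSum G⁺ (u ↑ˡ k) ⟩
    incidenceSum G⁺ (λ _ → 1) (u ↑ˡ k)
      ≡⟨ incidenceSum-old _ u ⟩
    incidenceSum G (λ _ → 1) u + pendantSum (λ _ → 1) u
      ≡⟨ cong (_+ pendantSum (λ _ → 1) u) (deg≡incidenceSum G u) ⟨
    deg G u + pendantSum (λ _ → 1) u
      ≡⟨ count (leafView u) ⟩
    pendantDeg (deg G u) ∎
    where
    open ≡-Reasoning
    count : ∀ {u} → LeafView u → deg G u + pendantSum (λ _ → 1) u ≡ pendantDeg (deg G u)
    count (isLeaf j) = trans (cong₂ _+_ (leaf-deg j) (pendantSum-leaf _ j)) (cong pendantDeg (sym (leaf-deg j)))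
    count {u} (notLeaf d≢1) = begin
      deg G u + pendantSum (λ _ → 1) u ≡⟨ cong (deg G u +_) (pendantSum-notLeaf (λ _ → 1) d≢1) ⟩
      deg G u + 0                      ≡⟨ +-identityʳ _ ⟩
      deg G u                          ≡⟨ pendantDeg-≢1 d≢1 ⟨
      pendantDeg (deg G u)             ∎

  deg-new : ∀ i → deg G⁺ (n G ↑ʳ i) ≡ 1
  deg-new i = trans (deg≡incidenceSum G⁺ (n G ↑ʳ i)) (incidenceSum-new _ i)

  pendantSum-≤ : ∀ {w c} → (∀ j → w j ≤ c) → ∀ u → pendantSum w u ≤ c
  pendantSum-≤ {w} {c} w≤c u = bound (leafView u)
    where
    bound : ∀ {u} → LeafView u → pendantSum w u ≤ c
    bound (isLeaf j)    = subst (_≤ c) (sym (pendantSum-leaf w j)) (w≤c j)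
    bound (notLeaf d≢1) = subst (_≤ c) (sym (pendantSum-notLeaf w d≢1)) z≤n

  module Relabelling (f : Labeling G) (f-sa : IsStronglyAntimagicLabeling G f)
                     (1≤deg : ∀ u → 1 ≤ deg G u) where

    φ : Fin (n G) → ℕ
    φ = vsum G f

    σ : Permutation′ k
    σ = proj₁ (ranking (φ ∘ leaf))

    σ-ranks : ∀ i j → φ (leaf i) < φ (leaf j) → toℕ (σ ⟨$⟩ʳ i) < toℕ (σ ⟨$⟩ʳ j)
    σ-ranks = proj₂ (ranking (φ ∘ leaf))

    g : Labeling G⁺
    g = f ⊕ₚ σ

    pendantLabel : Fin k → ℕ
    pendantLabel j = suc (toℕ (σ ⟨$⟩ʳ j))

    pendantLabel≤k : ∀ j → pendantLabel j ≤ k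
    pendantLabel≤k j = Fin.toℕ<n (σ ⟨$⟩ʳ j)

    pendantLabel-injective : ∀ {i j} → pendantLabel i ≡ pendantLabel j → i ≡ j
    pendantLabel-injective {i} {j} eq = begin
      i                     ≡⟨ inverseˡ σ ⟨
      σ ⟨$⟩ˡ (σ ⟨$⟩ʳ i)     ≡⟨ cong (σ ⟨$⟩ˡ_) (Fin.toℕ-injective (suc-injective eq)) ⟩
      σ ⟨$⟩ˡ (σ ⟨$⟩ʳ j)     ≡⟨ inverseˡ σ ⟩
      j                     ∎
      where open ≡-Reasoning

    Φ : Fin (n G) → ℕ
    Φ u = k * deg G u + φ u + pendantSum pendantLabel u

    vsum-old : ∀ u → vsum G⁺ g (u ↑ˡ k) ≡ Φ u
    vsum-old u = begin
      vsum G⁺ g (u ↑ˡ k)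
        ≡⟨ vsum≡incidenceSum G⁺ g (u ↑ˡ k) ⟩
      incidenceSum G⁺ (label G⁺ g) (u ↑ˡ k)
        ≡⟨ incidenceSum-old (label G⁺ g) u ⟩
      incidenceSum G (λ e → label G⁺ g (e ↑ˡ k)) u + pendantSum (λ j → label G⁺ g (m G ↑ʳ j)) u
        ≡⟨ cong₂ _+_ (sum-cong-≗ (λ e → cong (if incident G u e then_else 0) (old-label e)))
                     (sum-cong-≗ (λ j → cong (if ⌊ u ≟ leaf j ⌋ then_else 0)
                                            (cong suc (⊕ₚ-↑ʳ f σ j)))) ⟩
      incidenceSum G (λ e → k + label G f e) u + pendantSum pendantLabel u
        ≡⟨ cong (_+ pendantSum pendantLabel u) (trans (incidenceSum-shift G k (label G f) u)
                                           (cong (k * deg G u +_) (sym (vsum≡incidenceSum G f u)))) ⟩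
      Φ u ∎
      where
      open ≡-Reasoning
      old-label : ∀ e → label G⁺ g (e ↑ˡ k) ≡ k + label G f e
      old-label e = trans (cong suc (⊕ₚ-↑ˡ f σ e)) (sym (+-suc k _))

    vsum-new : ∀ i → vsum G⁺ g (n G ↑ʳ i) ≡ pendantLabel i
    vsum-new i = trans (vsum≡incidenceSum G⁺ g (n G ↑ʳ i))
                       (trans (incidenceSum-new (label G⁺ g) i) (cong suc (⊕ₚ-↑ʳ f σ i)))

    φ-injective : ∀ u v → u ≢ v → φ u ≢ φ v
    φ-injective = proj₁ f-sa

    φ-mono : ∀ u v → deg G u < deg G v → φ u < φ v
    φ-mono = proj₂ f-sa

    Φ-<-deg : ∀ u v → deg G u < deg G v → Φ u < Φ v
    Φ-<-deg u v lt = begin-strict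
      k * deg G u + φ u + pendantSum pendantLabel u
        ≤⟨ +-monoʳ-≤ (k * deg G u + φ u) (pendantSum-≤ pendantLabel≤k u) ⟩
      k * deg G u + φ u + k
        ≡⟨ reassoc k (deg G u) (φ u) ⟩
      k * suc (deg G u) + φ u
        <⟨ +-mono-≤-< (*-monoʳ-≤ k lt) (φ-mono u v lt) ⟩
      k * deg G v + φ v
        ≤⟨ m≤m+n _ (pendantSum pendantLabel v) ⟩
      Φ v ∎
      where
      open ≤-Reasoning
      open +-*-Solver
      reassoc : ∀ k d x → k * d + x + k ≡ k * suc d + x
      reassoc = solve 3 (λ k d x → k :* d :+ x :+ k := k :* (con 1 :+ d) :+ x) refl

    Φ-<-sameDeg : ∀ u v → deg G u ≡ deg G v → φ u < φ v → Φ u < Φ v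
    Φ-<-sameDeg u v eq lt =
      +-mono-<-≤ (+-mono-≤-< (≤-reflexive (cong (k *_) eq)) lt) (pendant-≤ (leafView u) (leafView v))
      where
      pendant-≤ : LeafView u → LeafView v → pendantSum pendantLabel u ≤ pendantSum pendantLabel v
      pendant-≤ (isLeaf i) (isLeaf j) =
        subst₂ _≤_ (sym (pendantSum-leaf pendantLabel i)) (sym (pendantSum-leaf pendantLabel j))
          (<⇒≤ (s≤s (σ-ranks i j lt)))
      pendant-≤ (notLeaf u≢1) (notLeaf v≢1) = ≤-reflexive
        (trans (pendantSum-notLeaf pendantLabel u≢1) (sym (pendantSum-notLeaf pendantLabel v≢1)))
      pendant-≤ (isLeaf i) (notLeaf v≢1) = contradiction (trans (sym eq) (leaf-deg i)) v≢1
      pendant-≤ (notLeaf u≢1) (isLeaf j) = contradiction (trans eq (leaf-deg j)) u≢1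

    Φ-injective : ∀ u v → u ≢ v → Φ u ≢ Φ v
    Φ-injective u v u≢v with <-cmp (deg G u) (deg G v)
    ... | tri< lt _ _ = <⇒≢ (Φ-<-deg u v lt)
    ... | tri> _ _ gt = >⇒≢ (Φ-<-deg v u gt)
    ... | tri≈ _ eq _ with <-cmp (φ u) (φ v)
    ...   | tri< lt _ _  = <⇒≢ (Φ-<-sameDeg u v eq lt)
    ...   | tri≈ _ φeq _ = contradiction φeq (φ-injective u v u≢v)
    ...   | tri> _ _ gt  = >⇒≢ (Φ-<-sameDeg v u (sym eq) gt)

    k<Φ : ∀ u → k < Φ u
    k<Φ u = begin-strict
      k                     ≡⟨ *-identityʳ k ⟨
      k * 1                 ≤⟨ *-monoʳ-≤ k (1≤deg u) ⟩
      k * deg G u           <⟨ m<m+n (k * deg G u) (≤-trans (1≤deg u) (deg≤vsum G f u)) ⟩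
      k * deg G u + φ u     ≤⟨ m≤m+n _ (pendantSum pendantLabel u) ⟩
      Φ u                   ∎
      where open ≤-Reasoning

    pendantLabel<Φ : ∀ j u → pendantLabel j < Φ u
    pendantLabel<Φ j u = ≤-<-trans (pendantLabel≤k j) (k<Φ u)

    g-injective : ∀ x y → x ≢ y → vsum G⁺ g x ≢ vsum G⁺ g y
    g-injective x y = go (splitView (n G) k x) (splitView (n G) k y)
      where
      go : ∀ {x y} → SplitView (n G) k x → SplitView (n G) k y → x ≢ y → vsum G⁺ g x ≢ vsum G⁺ g y
      go (left u) (left v) x≢y eq = Φ-injective u v (x≢y ∘ cong (_↑ˡ k))
        (trans (sym (vsum-old u)) (trans eq (vsum-old v)))
      go (left u) (right j) _ eq = <⇒≢ (pendantLabel<Φ j u)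
        (trans (sym (vsum-new j)) (trans (sym eq) (vsum-old u)))
      go (right i) (left v) _ eq = <⇒≢ (pendantLabel<Φ i v)
        (trans (sym (vsum-new i)) (trans eq (vsum-old v)))
      go (right i) (right j) x≢y eq = x≢y (cong (n G ↑ʳ_) (pendantLabel-injective
        (trans (sym (vsum-new i)) (trans eq (vsum-new j)))))

    g-mono : ∀ x y → deg G⁺ x < deg G⁺ y → vsum G⁺ g x < vsum G⁺ g y
    g-mono x y = go (splitView (n G) k x) (splitView (n G) k y)
      where
      go : ∀ {x y} → SplitView (n G) k x → SplitView (n G) k y →
           deg G⁺ x < deg G⁺ y → vsum G⁺ g x < vsum G⁺ g y
      go (left u) (left v) lt = subst₂ _<_ (sym (vsum-old u)) (sym (vsum-old v))
        (Φ-<-deg u v (pendantDeg-cancel-< (subst₂ _<_ (deg-old u) (deg-old v) lt)))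
      go (left u) (right j) lt = contradiction (subst₂ _<_ (deg-old u) (deg-new j) lt)
        (≤⇒≯ (≤-trans (1≤deg u) (≤-pendantDeg (deg G u))))
      go (right i) (left v) _ = subst₂ _<_ (sym (vsum-new i)) (sym (vsum-old v)) (pendantLabel<Φ i v)
      go (right i) (right j) lt = contradiction (subst₂ _<_ (deg-new i) (deg-new j) lt) (<-irrefl refl)

    g-stronglyAntimagic : IsStronglyAntimagicLabeling G⁺ g
    g-stronglyAntimagic = g-injective , g-mono

leaf-exists : ∀ G → leaves G ≢ [] → ∃[ ℓ ] deg G ℓ ≡ 1
leaf-exists G nonempty with leaves G in eq
... | []    = contradiction refl nonempty
... | ℓ ∷ _ = ℓ , proj₂ (∈-filter⁻ (λ u → deg G u ℕ.≟ 1) {xs = allFin (n G)}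
                                  (subst (ℓ ∈_) (sym eq) (here refl)))

connected⇒1≤deg : ∀ G → Connected G → leaves G ≢ [] → ∀ u → 1 ≤ deg G u
connected⇒1≤deg G connected nonempty u with leaf-exists G nonempty
... | ℓ , dℓ≡1 = path⇒1≤deg G (connected u ℓ) (≤-reflexive (sym dℓ≡1))

lemma1 : (G : Graph) → IsSimple G → Connected G → leaves G ≢ [] →
    StronglyAntimagic G → StronglyAntimagic (addPendants G)
lemma1 G _ connected nonempty (f , f-sa) = g , g-stronglyAntimagic
  where open PendantExtension.Relabelling G f f-sa (connected⇒1≤deg G connected nonempty)
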